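{- In the game \textsc{saliquant}, for all integers $a,b\geq 1$, $$\frac{(2a+1)2^b}{2}-a-1\leq \mathcal{SG}\left((2a+1)2^b\right)<\frac{(2a+1)2^b}{2}-\frac{1}{2}.$$
   Context: \textsc{saliquant} is the normal-play impartial game whose positions are the positive integers, where the options of a position $n\geq 1$ are $\{n-k : 1\leq k\leq n,\ k\nmid n\}$. The nim-value is defined recursively by $\mathcal{SG}(n)=\operatorname{mex}\{\mathcal{SG}(x) : x \text{ an option of } n\}$, where $\operatorname{mex}(A)$ is the least nonnegative integer not in $A$. -}

module Defs where

open import Data.Nat using (ℕ; zero; suc; _∸_; _≟_)
open import Data.Nat.Divisibility using (_∣?_)
open import Data.List using (List; []; _∷_; length)
open import Data.List.Membership.DecPropositional _≟_ using (_∈?_)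
open import Relation.Nullary using (yes; no)

-- mex of a finite list: least natural number not in the list.
-- Search from m upward; the answer is ≤ length xs, so suc (length xs) steps suffice.
mexSearch : List ℕ → ℕ → ℕ → ℕ
mexSearch xs m zero = m
mexSearch xs m (suc fuel) with m ∈? xs
... | yes _ = mexSearch xs (suc m) fuel
... | no  _ = m

mex : List ℕ → ℕ
mex xs = mexSearch xs 0 (suc (length xs))

-- sgF fuel n : Sprague-Grundy value of SALIQUANT position n, computed with
-- recursion depth 'fuel' (correct whenever fuel ≥ n, since every option of n
-- is strictly smaller than n).
-- optVals fuel n k collects SG(n - j) for 1 ≤ j ≤ k with j ∤ n.
mutual
  sgF : ℕ → ℕ → ℕ
  sgF zero    n = 0
  sgF (suc f) n = mex (optVals f n n)

  optVals : ℕ → ℕ → ℕ → List ℕ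
  optVals f n zero = []
  optVals f n (suc k) with suc k ∣? n
  ... | yes _ = optVals f n k
  ... | no  _ = sgF f (n ∸ suc k) ∷ optVals f n k

SG : ℕ → ℕ
SG n = sgF n n

-- Every legal move removes at least 2 tokens (1 and n always divide n), so by induction
-- 2 SG(n) + 1 ≤ n; for even n the inequality is strict.  An odd position 2v + 1 can remove
-- any even number of tokens, reaching every odd 2u + 1 below it, so SG(2v + 1) = v.
-- For N = (2a + 1) 2^b with b ≥ 1 every odd divisor of N divides 2a + 1, so removing an odd
-- number j > 2a + 1 of tokens is legal; these moves reach every odd position 2u + 1 with
-- 2u + 1 < N - 2a - 1, whence SG(N) ≥ N/2 - a - 1.
module Submission where

open import Defs
open import Data.Nat using (ℕ; _+_; _*_; _^_; _≤_; _<_)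
open import Data.Product using (_×_)

open import Data.Nat using (zero; suc; _∸_; z≤n; s≤s; >-nonZero)
open import Data.Nat.Properties
open import Data.Nat.Divisibility
open import Data.Nat.Coprimality using (Coprime; coprime-divisor)
open import Data.Nat.Tactic.RingSolver using (solve-∀)
open import Data.List using (List; length; lookup)
open import Data.List.Membership.Propositional using (_∈_)
open import Data.List.Membership.DecPropositional _≟_ using (_∈?_)
open import Data.List.Relation.Unary.Any using (here; there; index)
open import Data.List.Relation.Unary.Any.Properties using (lookup-index)
open import Data.Fin using (Fin; toℕ)
open import Data.Fin.Properties using (pigeonhole; toℕ<n)
open import Data.Product using (∃-syntax; _,_; proj₁; proj₂)
open import Data.Sum using (inj₁; inj₂)
open import Function using (_∘_)
open import Relation.Nullary using (¬_; yes; no; contradiction)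
open import Relation.Binary.PropositionalEquality

mex-induction : (P : ℕ → Set) {xs : List ℕ} →
  P 0 → (∀ {m} → m ∈ xs → P m → P (suc m)) → P (mex xs)
mex-induction P {xs} P0 step = go 0 (suc (length xs)) P0
  where
  go : ∀ m fuel → P m → P (mexSearch xs m fuel)
  go m zero       Pm = Pm
  go m (suc fuel) Pm with m ∈? xs
  ... | yes m∈xs = go (suc m) fuel (step m∈xs Pm)
  ... | no  _    = Pm

covers⇒≤length : ∀ {c} (xs : List ℕ) → (∀ {j} → j < c → j ∈ xs) → c ≤ length xs
covers⇒≤length {c} xs covers = ≮⇒≥ no-collision
  where
  position : Fin c → Fin (length xs)
  position i = index (covers (toℕ<n i))

  position-injective : ∀ {i j} → position i ≡ position j → toℕ i ≡ toℕ j
  position-injective {i} {j} same-position = begin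
    toℕ i                     ≡⟨ lookup-index (covers (toℕ<n i)) ⟩
    lookup xs (position i)    ≡⟨ cong (lookup xs) same-position ⟩
    lookup xs (position j)    ≡⟨ lookup-index (covers (toℕ<n j)) ⟨
    toℕ j                     ∎
    where open ≡-Reasoning

  no-collision : ¬ (length xs < c)
  no-collision len<c with pigeonhole len<c position
  ... | i , j , i<j , same-position = <⇒≢ i<j (position-injective same-position)

≤-mex : ∀ {c} (xs : List ℕ) → (∀ {j} → j < c → j ∈ xs) → c ≤ mex xs
≤-mex {c} xs covers = go 0 (suc (length xs)) (m≤n⇒m≤1+n (covers⇒≤length xs covers))
  where
  go : ∀ m fuel → c ≤ m + fuel → c ≤ mexSearch xs m fuel
  go m zero       c≤m+0 = subst (c ≤_) (+-identityʳ m) c≤m+0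
  go m (suc fuel) c≤m+1+fuel with m ∈? xs
  ... | yes _   = go (suc m) fuel (subst (c ≤_) (+-suc m fuel) c≤m+1+fuel)
  ... | no  m∉xs = ≮⇒≥ (m∉xs ∘ covers)

BoundedMove : ℕ → ℕ → ℕ → Set
BoundedMove k n j = 1 ≤ j × j ≤ k × ¬ (j ∣ n)

LegalMove : ℕ → ℕ → Set
LegalMove n = BoundedMove n n

boundedMove-suc : ∀ {k n j} → BoundedMove k n j → BoundedMove (suc k) n j
boundedMove-suc (1≤j , j≤k , j∤n) = 1≤j , m≤n⇒m≤1+n j≤k , j∤n

legalMove-bounds : ∀ {n j} → LegalMove n j → 2 ≤ j × j < n
legalMove-bounds {n} {j} (1≤j , j≤n , j∤n) =
  ≤∧≢⇒< 1≤j (λ 1≡j → j∤n (subst (_∣ n) 1≡j (1∣ n))) ,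
  ≤∧≢⇒< j≤n (λ j≡n → j∤n (subst (j ∣_) j≡n ∣-refl))

optVals-step : ∀ {f n k x} → x ∈ optVals f n k → x ∈ optVals f n (suc k)
optVals-step {f} {n} {k} x∈ with suc k ∣? n
... | yes _ = x∈
... | no  _ = there x∈

∈-optVals⁺ : ∀ {f n k j} → BoundedMove k n j → sgF f (n ∸ j) ∈ optVals f n k
∈-optVals⁺ {k = zero} (1≤j , j≤0 , _) = contradiction (≤-trans 1≤j j≤0) λ ()
∈-optVals⁺ {f} {n} {suc k} (1≤j , j≤1+k , j∤n) with m≤n⇒m<n∨m≡n j≤1+k
... | inj₁ (s≤s j≤k) = optVals-step {f} {n} {k} (∈-optVals⁺ {f} {n} {k} (1≤j , j≤k , j∤n))
... | inj₂ refl with suc k ∣? n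
...   | yes j∣n = contradiction j∣n j∤n
...   | no  _   = here refl

∈-optVals⁻ : ∀ {f n k e} → e ∈ optVals f n k → ∃[ j ] (BoundedMove k n j × e ≡ sgF f (n ∸ j))
∈-optVals⁻ {k = zero} ()
∈-optVals⁻ {f} {n} {suc k} e∈ with suc k ∣? n
∈-optVals⁻ {f} {n} {suc k} e∈         | yes _ with ∈-optVals⁻ {f} {n} {k} e∈
... | j , move , eq = j , boundedMove-suc move , eq
∈-optVals⁻ {f} {n} {suc k} (here eq)  | no j∤n = suc k , (s≤s z≤n , ≤-refl , j∤n) , eq
∈-optVals⁻ {f} {n} {suc k} (there e∈) | no _ with ∈-optVals⁻ {f} {n} {k} e∈
... | j , move , eq = j , boundedMove-suc move , eq

≤-sgF : ∀ {f n c} → (∀ {u} → u < c → ∃[ j ] (LegalMove n j × sgF f (n ∸ j) ≡ u)) →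
  c ≤ sgF (suc f) n
≤-sgF {f} {n} {c} reach = ≤-mex (optVals f n n) reached∈
  where
  reached∈ : ∀ {u} → u < c → u ∈ optVals f n n
  reached∈ u<c with reach u<c
  ... | j , move , refl = ∈-optVals⁺ move

sgF-upper : ∀ f {n} → 1 ≤ n → 2 * sgF f n + 1 ≤ n
sgF-upper zero    1≤n = 1≤n
sgF-upper (suc f) {n} 1≤n = mex-induction (λ m → 2 * m + 1 ≤ n) 1≤n step
  where
  step : ∀ {m} → m ∈ optVals f n n → 2 * m + 1 ≤ n → 2 * suc m + 1 ≤ n
  step m∈ _ with ∈-optVals⁻ {f} {n} {n} m∈
  ... | j , move , refl = begin
    2 * suc m + 1    ≡⟨ shift m ⟩
    2 + (2 * m + 1)  ≤⟨ +-mono-≤ 2≤j (sgF-upper f (m<n⇒0<n∸m j<n)) ⟩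
    j + (n ∸ j)      ≡⟨ m+[n∸m]≡n (<⇒≤ j<n) ⟩
    n                ∎
    where
    open ≤-Reasoning
    m = sgF f (n ∸ j)
    2≤j = proj₁ (legalMove-bounds move)
    j<n = proj₂ (legalMove-bounds move)
    shift : ∀ m → 2 * suc m + 1 ≡ 2 + (2 * m + 1)
    shift = solve-∀

2∤odd : ∀ w → ¬ (2 ∣ 2 * w + 1)
2∤odd w (divides q odd≡q*2) =
  even≢odd q w (trans (*-comm 2 q) (trans (sym odd≡q*2) (+-comm (2 * w) 1)))

sgF-upper-even : ∀ f {m} → 1 ≤ m → 2 * sgF f (2 * m) + 1 < 2 * m
sgF-upper-even f {m} 1≤m = ≤∧≢⇒< (sgF-upper f (≤-trans 1≤m (m≤n*m m 2)))
  λ odd≡even → 2∤odd (sgF f (2 * m)) (subst (2 ∣_) (sym odd≡even) (m∣m*n m))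

odd-cancel-≤ : ∀ {m n} → 2 * m + 1 ≤ 2 * n + 1 → m ≤ n
odd-cancel-≤ {m} {n} le = *-cancelˡ-≤ 2 (+-cancelʳ-≤ 1 (2 * m) (2 * n) le)

mutual
  sgF-odd : ∀ {f} v → 2 * v + 1 ≤ f → sgF f (2 * v + 1) ≡ v
  sgF-odd {zero}  v le = contradiction (≤-trans (m≤n+m 1 (2 * v)) le) λ ()
  sgF-odd {suc f} v le = ≤-antisym
    (odd-cancel-≤ (sgF-upper (suc f) (m≤n+m 1 (2 * v))))
    (≤-sgF reach)
    where
    reach : ∀ {u} → u < v → ∃[ j ] (LegalMove (2 * v + 1) j × sgF f (2 * v + 1 ∸ j) ≡ u)
    reach {u} u<v with m≤n⇒∃[o]m+o≡n u<v
    ... | d , refl = odd-option u (split u d) (s≤s z≤n) even∤odd le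
      where
      split : ∀ u d → 2 * (suc u + d) + 1 ≡ (2 * u + 1) + 2 * suc d
      split = solve-∀
      even∤odd : ¬ (2 * suc d ∣ 2 * (suc u + d) + 1)
      even∤odd = 2∤odd (suc u + d) ∘ m*n∣⇒m∣ 2 (suc d)

  odd-option : ∀ {f n} u {j} → n ≡ (2 * u + 1) + j → 1 ≤ j → ¬ (j ∣ n) → n ≤ suc f →
    ∃[ j ] (LegalMove n j × sgF f (n ∸ j) ≡ u)
  odd-option {f} u {j} refl 1≤j j∤n n≤1+f =
    j , (1≤j , m≤n+m j (2 * u + 1) , j∤n) ,
    trans (cong (sgF f) (m+n∸n≡m (2 * u + 1) j))
          (sgF-odd u (≤-pred (≤-trans (m<m+n (2 * u + 1) 1≤j) n≤1+f)))

SG-even-lower : ∀ a m → suc a ≤ m → (∀ {w} → 2 * w + 1 ∣ 2 * m → w ≤ a) →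
  2 * m ≤ 2 * SG (2 * m) + 2 * a + 2
SG-even-lower a m a<m oddDivisor≤ with m≤n⇒∃[o]m+o≡n a<m
... | c , refl = begin
  2 * (suc a + c)          ≡⟨ rearrange a c ⟩
  2 * c + 2 * a + 2        ≤⟨ +-monoˡ-≤ 2 (+-monoˡ-≤ (2 * a) (*-monoʳ-≤ 2 (≤-sgF reach))) ⟩
  2 * SG n + 2 * a + 2     ∎
  where
  open ≤-Reasoning
  n = 2 * (suc a + c)
  rearrange : ∀ a c → 2 * (suc a + c) ≡ 2 * c + 2 * a + 2
  rearrange = solve-∀
  reach : ∀ {u} → u < c → ∃[ j ] (LegalMove n j × sgF (n ∸ 1) (n ∸ j) ≡ u)
  reach {u} u<c with m≤n⇒∃[o]m+o≡n u<c
  ... | d , refl = odd-option u (split a u d) (m≤n+m 1 (2 * suc (a + d))) odd∤n ≤-refl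
    where
    split : ∀ a u d → 2 * (suc a + (suc u + d)) ≡ (2 * u + 1) + (2 * suc (a + d) + 1)
    split = solve-∀
    odd∤n : ¬ (2 * suc (a + d) + 1 ∣ n)
    odd∤n = m+n≮m a d ∘ oddDivisor≤

odd-coprime-2 : ∀ w → Coprime (2 * w + 1) 2
odd-coprime-2 w {0}                 (_ , 0∣2)    = contradiction (0∣⇒≡0 0∣2) λ ()
odd-coprime-2 w {1}                 _            = refl
odd-coprime-2 w {2}                 (2∣odd , _)  = contradiction 2∣odd (2∤odd w)
odd-coprime-2 w {suc (suc (suc _))} (_ , d∣2)    = contradiction (∣⇒≤ d∣2) λ { (s≤s (s≤s ())) }

coprime-divisor-^ : ∀ {d m o} b → Coprime d m → d ∣ m ^ b * o → d ∣ o
coprime-divisor-^ {d} {o = o} zero    _ d∣1*o = subst (d ∣_) (*-identityˡ o) d∣1*o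
coprime-divisor-^ {d} {m} {o} (suc b) coprime d∣m*m^b*o =
  coprime-divisor-^ b coprime (coprime-divisor coprime (subst (d ∣_) (*-assoc m (m ^ b) o) d∣m*m^b*o))

odd-∣-≤ : ∀ {w a} → 2 * w + 1 ∣ 2 * a + 1 → w ≤ a
odd-∣-≤ {a = a} d = odd-cancel-≤ (∣⇒≤ ⦃ >-nonZero (m≤n+m 1 (2 * a)) ⦄ d)

mainTheorem15 : (a b : ℕ) → 1 ≤ a → 1 ≤ b →
    ((2 * a + 1) * 2 ^ b ≤ 2 * SG ((2 * a + 1) * 2 ^ b) + 2 * a + 2)
    × (2 * SG ((2 * a + 1) * 2 ^ b) + 1 < (2 * a + 1) * 2 ^ b)
mainTheorem15 a zero    _ ()
mainTheorem15 a (suc b) _ _ =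
  subst (λ n → (n ≤ 2 * SG n + 2 * a + 2) × (2 * SG n + 1 < n)) (sym N≡2M)
    (SG-even-lower a M a<M oddDivisor≤ , sgF-upper-even (2 * M) (≤-trans (s≤s z≤n) a<M))
  where
  M = 2 ^ b * (2 * a + 1)
  N≡2M : (2 * a + 1) * 2 ^ suc b ≡ 2 * M
  N≡2M = regroup a (2 ^ b)
    where
    regroup : ∀ a p → (2 * a + 1) * (2 * p) ≡ 2 * (p * (2 * a + 1))
    regroup = solve-∀
  a<M : suc a ≤ M
  a<M = ≤-trans (≤-trans (m≤n+m (suc a) a) (≤-reflexive (double a)))
                (m≤n*m (2 * a + 1) (2 ^ b) ⦃ m^n≢0 2 b ⦄)
    where
    double : ∀ a → a + suc a ≡ 2 * a + 1
    double = solve-∀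
  oddDivisor≤ : ∀ {w} → 2 * w + 1 ∣ 2 * M → w ≤ a
  oddDivisor≤ {w} = odd-∣-≤ ∘ coprime-divisor-^ b (odd-coprime-2 w) ∘ coprime-divisor (odd-coprime-2 w)
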